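{- Let $q>2$ and let $C$ be a $\lambda$-fold $1$-packing in $H(n,q)$ containing the all-zero word $\mathbf{0}$, with weight distribution $(A_i(\mathbf{0}))_{i=0}^n$, where $A_i(\mathbf{0}):=|\{\mathbf{y}\in C:\ d(\mathbf{0},\mathbf{y})=i\}|$. Then \[ n(q-1)A_0(\mathbf{0}) + 2(q-1)A_1(\mathbf{0})+2A_2(\mathbf{0}) \le (n+1)(q-1)\lambda - q+1; \] moreover, if $q$, $n$, and $\lambda$ are even, then \[ n(q-1)A_0(\mathbf{0}) + 2(q-1)A_1(\mathbf{0})+2A_2(\mathbf{0}) \le (n+1)(q-1)\lambda - q; \] and if one of these relations holds with equality, then $A_0(\mathbf{0})=1$ and $A_1(\mathbf{0})=\lambda-1$.
   Context: $H(n,q)$ is the Hamming graph on the $n$-words over $\{0,1,\ldots,q-1\}$, adjacent words differing in exactly one position; $d(\cdot,\cdot)$ is the Hamming distance. A $\lambda$-fold $1$-packing is a multiset $C$ of vertices such that the radius-$1$ balls centered at the words of $C$ cover each vertex not more than $\lambda$ times. The weight distribution of $C$ is the sequence $(A_i(\mathbf{0}))_{i=0}^n$ counted with multiplicity. -}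

module Defs where

open import Data.Nat using (ℕ; zero; suc; _+_; _≤_; _<_; _≤?_; _≟_)
open import Data.Fin using (Fin)
import Data.Fin as F
open import Data.Vec using (Vec; []; _∷_; replicate)
open import Data.List using (List; length; filter)
open import Data.Bool using (if_then_else_)
open import Relation.Nullary.Decidable using (⌊_⌋)

Word : ℕ → ℕ → Set
Word n q = Vec (Fin q) n

dist : ∀ {n q} → Word n q → Word n q → ℕ
dist [] [] = 0
dist (x ∷ xs) (y ∷ ys) = (if ⌊ x F.≟ y ⌋ then 0 else 1) + dist xs ys

zeroSym : ∀ {q} → 2 < q → Fin q
zeroSym {suc q} _ = F.zero

zeroWord : ∀ {q} (n : ℕ) → 2 < q → Word n q
zeroWord n q>2 = replicate n (zeroSym q>2)

-- a multiset of words is represented as a list (multiplicities = repetitions)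
-- number of codewords (with multiplicity) whose radius-1 ball contains x
ballCount : ∀ {n q} → List (Word n q) → Word n q → ℕ
ballCount C x = length (filter (λ c → dist x c ≤? 1) C)

IsPacking : ∀ {n q} → ℕ → List (Word n q) → Set
IsPacking {n} {q} λ' C = (x : Word n q) → ballCount C x ≤ λ'

A : ∀ {n q} → List (Word n q) → Word n q → ℕ → ℕ
A C x i = length (filter (λ c → dist x c ≟ i) C)

-- Count the pairs (x, c) with x in the radius-1 ball B around 𝟎, c ∈ C and d(x, c) ≤ 1.
-- Every x is covered at most λ times and |B| = 1 + n(q−1), while a codeword at distance
-- 0, 1, 2 from 𝟎 meets B in at least 1 + n(q−1), q, 2 words; hence
--   (1 + n(q−1)) A₀ + q A₁ + 2 A₂ ≤ (1 + n(q−1)) λ.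
-- Adding (q−2) λ ≥ (q−2)(A₀ + A₁) (the word 𝟎 itself is covered at most λ times) and using
-- A₀ ≥ 1 gives the first bound with slack (q−1)(A₀−1) + (q−2)(λ−A₀−A₁), so equality forces
-- A₀ = 1 and A₁ = λ − 1.  If q, n and λ are even, both sides of the bound are even while
-- q − 1 is odd, so the bound improves by one, and equality there leaves a slack of at most
-- 1 < q − 2.
module Submission where

open import Defs
open import Data.Bool using (true; false; if_then_else_)
open import Data.Fin using (Fin)
import Data.Fin as F
open import Data.List using (List; []; _∷_; [_]; _++_; map; length; filter; allFin)
open import Data.List.Properties
  using (length-++; length-map; length-tabulate; filter-++; filter-all; filter-some; map-cong)
open import Data.List.Membership.Propositional using (_∈_; lose)
open import Data.List.Membership.Propositional.Properties using (∈-map⁺; ∈-++⁺ˡ; ∈-++⁺ʳ; ∈-allFin)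
open import Data.List.Relation.Unary.All as All using (All; universal)
import Data.List.Relation.Unary.All.Properties as All
open import Data.List.Relation.Unary.Any using (here)
open import Data.Nat using (ℕ; zero; suc; _+_; _*_; _∸_; _<_; z≤n; s≤s; _≤?_; _≟_)
import Data.Nat as ℕ
open import Data.Nat.Properties
open import Data.Nat.Divisibility using (_∣_; ∣m+n∣m⇒∣n; ∣m∣n⇒∣m+n; ∣m⇒∣m*n; ∣n⇒∣m*n; m∣m*n; ∣1⇒≡1)
open import Data.Nat.ListAction using (sum)
open import Data.Nat.Tactic.RingSolver using (solve-∀)
open import Data.Product using (_×_; _,_)
open import Data.Sum using (_⊎_; inj₁; inj₂)
open import Data.Vec using ([]; _∷_; replicate)
open import Function using (_∘_)
open import Relation.Nullary using (Dec; yes; no; does; ¬_; contradiction)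
open import Relation.Unary using (Pred; Decidable)
open import Relation.Binary.PropositionalEquality
  using (_≡_; _≢_; refl; sym; trans; cong; cong₂; subst; module ≡-Reasoning)
open import Algebra.Properties.CommutativeSemigroup +-commutativeSemigroup using (interchange)

-- ℕ's order is opened only inside this block: the theorem at the end is stated with ℤ's _≤_.
module _ where
  open import Data.Nat using (_≤_)

  𝟙 : ∀ {p} {P : Set p} → Dec P → ℕ
  𝟙 P? = if does P? then 1 else 0

  module _ {a} {A : Set a} where

    ∑ : (A → ℕ) → List A → ℕ
    ∑ f xs = sum (map f xs)

    ∑-zero : (xs : List A) → ∑ (λ _ → 0) xs ≡ 0
    ∑-zero []       = refl
    ∑-zero (_ ∷ xs) = ∑-zero xs

    ∑-+ : (f g : A → ℕ) (xs : List A) → ∑ (λ x → f x + g x) xs ≡ ∑ f xs + ∑ g xs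
    ∑-+ f g []       = refl
    ∑-+ f g (x ∷ xs) =
      trans (cong ((f x + g x) +_) (∑-+ f g xs)) (interchange (f x) (g x) (∑ f xs) (∑ g xs))

    ∑-mono-≤ : {f g : A → ℕ} → (∀ x → f x ≤ g x) → (xs : List A) → ∑ f xs ≤ ∑ g xs
    ∑-mono-≤ f≤g []       = z≤n
    ∑-mono-≤ f≤g (x ∷ xs) = +-mono-≤ (f≤g x) (∑-mono-≤ f≤g xs)

    ∑≤length* : {f : A → ℕ} {b : ℕ} → (∀ x → f x ≤ b) → (xs : List A) → ∑ f xs ≤ length xs * b
    ∑≤length* f≤b []       = z≤n
    ∑≤length* f≤b (x ∷ xs) = +-mono-≤ (f≤b x) (∑≤length* f≤b xs)

    count : ∀ {p} {P : Pred A p} → Decidable P → List A → ℕ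
    count P? xs = length (filter P? xs)

    module _ {p} {P : Pred A p} (P? : Decidable P) where

      count-∷ : ∀ x xs → count P? (x ∷ xs) ≡ 𝟙 (P? x) + count P? xs
      count-∷ x xs with does (P? x)
      ... | true  = refl
      ... | false = refl

      count≡∑𝟙 : ∀ xs → count P? xs ≡ ∑ (λ x → 𝟙 (P? x)) xs
      count≡∑𝟙 []       = refl
      count≡∑𝟙 (x ∷ xs) = trans (count-∷ x xs) (cong (𝟙 (P? x) +_) (count≡∑𝟙 xs))

      count-++ : ∀ xs ys → count P? (xs ++ ys) ≡ count P? xs + count P? ys
      count-++ xs ys = trans (cong length (filter-++ P? xs ys)) (length-++ (filter P? xs))

      count-all : ∀ {xs} → All P xs → count P? xs ≡ length xs
      count-all all = cong length (filter-all P? all)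

      count-∈ : ∀ {x xs} → x ∈ xs → P x → 1 ≤ count P? xs
      count-∈ x∈xs px = filter-some P? (lose x∈xs px)

  count-map : ∀ {a b p} {A : Set a} {B : Set b} {P : Pred B p} (P? : Decidable P) (f : A → B) xs →
              count P? (map f xs) ≡ count (P? ∘ f) xs
  count-map P? f []       = refl
  count-map P? f (x ∷ xs) with does (P? (f x))
  ... | true  = cong suc (count-map P? f xs)
  ... | false = count-map P? f xs

  ∑-count-comm : ∀ {a b r} {A : Set a} {B : Set b} {R : A → B → Set r}
                 (R? : ∀ x y → Dec (R x y)) xs ys →
                 ∑ (λ x → count (R? x) ys) xs ≡ ∑ (λ y → count (λ x → R? x y) xs) ys
  ∑-count-comm R? []       ys = sym (∑-zero ys)
  ∑-count-comm R? (x ∷ xs) ys = begin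
    count (R? x) ys + ∑ (λ x → count (R? x) ys) xs
      ≡⟨ cong₂ _+_ (count≡∑𝟙 (R? x) ys) (∑-count-comm R? xs ys) ⟩
    ∑ (λ y → 𝟙 (R? x y)) ys + ∑ (λ y → count (λ x → R? x y) xs) ys
      ≡⟨ ∑-+ (λ y → 𝟙 (R? x y)) (λ y → count (λ x → R? x y) xs) ys ⟨
    ∑ (λ y → 𝟙 (R? x y) + count (λ x → R? x y) xs) ys
      ≡⟨ cong sum (map-cong (λ y → sym (count-∷ (λ x → R? x y) x xs)) ys) ⟩
    ∑ (λ y → count (λ x → R? x y) (x ∷ xs)) ys ∎
    where open ≡-Reasoning

  w₀₁₂ : ℕ → ℕ → ℕ → ℕ → ℕ
  w₀₁₂ b₀ b₁ b₂ 0 = b₀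
  w₀₁₂ b₀ b₁ b₂ 1 = b₁
  w₀₁₂ b₀ b₁ b₂ 2 = b₂
  w₀₁₂ b₀ b₁ b₂ _ = 0

  module _ {a} {A : Set a} (f : A → ℕ) where

    ∑-w₀₁₂ : ∀ b₀ b₁ b₂ xs →
             ∑ (λ x → w₀₁₂ b₀ b₁ b₂ (f x)) xs ≡
             b₀ * count (λ x → f x ≟ 0) xs + b₁ * count (λ x → f x ≟ 1) xs + b₂ * count (λ x → f x ≟ 2) xs
    ∑-w₀₁₂ b₀ b₁ b₂ [] rewrite *-zeroʳ b₀ | *-zeroʳ b₁ | *-zeroʳ b₂ = refl
    ∑-w₀₁₂ b₀ b₁ b₂ (x ∷ xs) with f x | ∑-w₀₁₂ b₀ b₁ b₂ xs
    ... | 0                 | ih = trans (cong (b₀ +_) ih) (add₀ b₀ b₁ b₂ _ _ _)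
      where
      add₀ : ∀ b₀ b₁ b₂ c₀ c₁ c₂ →
             b₀ + (b₀ * c₀ + b₁ * c₁ + b₂ * c₂) ≡ b₀ * suc c₀ + b₁ * c₁ + b₂ * c₂
      add₀ = solve-∀
    ... | 1                 | ih = trans (cong (b₁ +_) ih) (add₁ b₀ b₁ b₂ _ _ _)
      where
      add₁ : ∀ b₀ b₁ b₂ c₀ c₁ c₂ →
             b₁ + (b₀ * c₀ + b₁ * c₁ + b₂ * c₂) ≡ b₀ * c₀ + b₁ * suc c₁ + b₂ * c₂
      add₁ = solve-∀
    ... | 2                 | ih = trans (cong (b₂ +_) ih) (add₂ b₀ b₁ b₂ _ _ _)
      where
      add₂ : ∀ b₀ b₁ b₂ c₀ c₁ c₂ →
             b₂ + (b₀ * c₀ + b₁ * c₁ + b₂ * c₂) ≡ b₀ * c₀ + b₁ * c₁ + b₂ * suc c₂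
      add₂ = solve-∀
    ... | suc (suc (suc _)) | ih = ih

    count-≤1 : ∀ xs → count (λ x → f x ≤? 1) xs ≡ count (λ x → f x ≟ 0) xs + count (λ x → f x ≟ 1) xs
    count-≤1 []       = refl
    count-≤1 (x ∷ xs) with f x | count-≤1 xs
    ... | 0           | ih = cong suc ih
    ... | 1           | ih = trans (cong suc ih) (sym (+-suc _ _))
    ... | suc (suc _) | ih = ih

  module _ {q : ℕ} where

    dist-∷-same : ∀ {n} (x : Fin q) (xs ys : Word n q) → dist (x ∷ xs) (x ∷ ys) ≡ dist xs ys
    dist-∷-same x xs ys with x F.≟ x
    ... | yes _   = refl
    ... | no x≢x = contradiction refl x≢x

    dist-refl : ∀ {n} (xs : Word n q) → dist xs xs ≡ 0
    dist-refl []       = refl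
    dist-refl (x ∷ xs) = trans (dist-∷-same x xs xs) (dist-refl xs)

    dist≡0⇒≡ : ∀ {n} {xs ys : Word n q} → dist xs ys ≡ 0 → xs ≡ ys
    dist≡0⇒≡ {xs = []}     {[]}     _   = refl
    dist≡0⇒≡ {xs = x ∷ xs} {y ∷ ys} d≡0 with x F.≟ y
    ... | yes refl = cong (x ∷_) (dist≡0⇒≡ d≡0)
    ... | no _     = contradiction d≡0 λ ()

    dist-∷-≤1 : ∀ {n} (x y : Fin q) (xs : Word n q) → dist (x ∷ xs) (y ∷ xs) ≤ 1
    dist-∷-≤1 x y xs with x F.≟ y
    ... | yes _ = ≤-trans (≤-reflexive (dist-refl xs)) z≤n
    ... | no _  = s≤s (≤-reflexive (dist-refl xs))

  module _ {m : ℕ} where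

    𝟎 : ∀ n → Word n (suc m)
    𝟎 n = replicate n F.zero

    ball𝟎 : ∀ n → List (Word n (suc m))
    ball𝟎 zero    = [ [] ]
    ball𝟎 (suc n) = map (F.zero ∷_) (ball𝟎 n) ++ map (λ a → F.suc a ∷ 𝟎 n) (allFin m)

    length-ball𝟎 : ∀ n → length (ball𝟎 n) ≡ suc (n * m)
    length-ball𝟎 zero    = refl
    length-ball𝟎 (suc n) = begin
      length (map (F.zero ∷_) (ball𝟎 n) ++ map (λ a → F.suc a ∷ 𝟎 n) (allFin m))
        ≡⟨ length-++ (map (F.zero ∷_) (ball𝟎 n)) ⟩
      length (map (F.zero ∷_) (ball𝟎 n)) + length (map (λ a → F.suc a ∷ 𝟎 n) (allFin m))
        ≡⟨ cong₂ _+_ (trans (length-map _ (ball𝟎 n)) (length-ball𝟎 n))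
                     (trans (length-map _ (allFin m)) (length-tabulate (λ a → a))) ⟩
      suc (n * m) + m
        ≡⟨ cong suc (+-comm (n * m) m) ⟩
      suc (suc n * m) ∎
      where open ≡-Reasoning

    ball𝟎-sound : ∀ n → All (λ x → dist x (𝟎 n) ≤ 1) (ball𝟎 n)
    ball𝟎-sound zero    = z≤n All.∷ All.[]
    ball𝟎-sound (suc n) =
      All.++⁺ (All.map⁺ (ball𝟎-sound n))
              (All.map⁺ (universal (λ _ → s≤s (≤-reflexive (dist-refl (𝟎 n)))) (allFin m)))

    ball𝟎-complete : ∀ {n} {x : Word n (suc m)} → dist (𝟎 n) x ≤ 1 → x ∈ ball𝟎 n
    ball𝟎-complete {x = []}         _   = here refl
    ball𝟎-complete {x = F.zero ∷ x} d≤1 = ∈-++⁺ˡ (∈-map⁺ (F.zero ∷_) (ball𝟎-complete d≤1))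
    ball𝟎-complete {n = suc n} {x = F.suc a ∷ x} (s≤s d≤0)
      with refl ← dist≡0⇒≡ {xs = 𝟎 n} {x} (n≤0⇒n≡0 d≤0) =
      ∈-++⁺ʳ (map (F.zero ∷_) (ball𝟎 n)) (∈-map⁺ (λ a → F.suc a ∷ 𝟎 n) (∈-allFin a))

    count-ball𝟎-suc : ∀ {n p} {P : Pred (Word (suc n) (suc m)) p} (P? : Decidable P) →
                      count P? (ball𝟎 (suc n)) ≡
                      count (λ x → P? (F.zero ∷ x)) (ball𝟎 n) + count (λ a → P? (F.suc a ∷ 𝟎 n)) (allFin m)
    count-ball𝟎-suc {n} P? = trans (count-++ P? (map (F.zero ∷_) (ball𝟎 n)) _)
                                   (cong₂ _+_ (count-map P? _ (ball𝟎 n)) (count-map P? _ (allFin m)))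

    ball𝟎-overlap₀ : ∀ {n} (c : Word n (suc m)) → dist (𝟎 n) c ≡ 0 →
                     suc (n * m) ≤ count (λ x → dist x c ≤? 1) (ball𝟎 n)
    ball𝟎-overlap₀ {n} c d≡0 with refl ← dist≡0⇒≡ {xs = 𝟎 n} {c} d≡0 =
      ≤-reflexive (sym (trans (count-all (λ x → dist x (𝟎 n) ≤? 1) (ball𝟎-sound n)) (length-ball𝟎 n)))

    ball𝟎-overlap₁ : ∀ {n} (c : Word n (suc m)) → dist (𝟎 n) c ≡ 1 →
                     suc m ≤ count (λ x → dist x c ≤? 1) (ball𝟎 n)
    ball𝟎-overlap₁ []          ()
    ball𝟎-overlap₁ {suc n} (F.zero ∷ c) d≡1
      rewrite count-ball𝟎-suc (λ x → dist x (F.zero ∷ c) ≤? 1) =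
      ≤-trans (ball𝟎-overlap₁ c d≡1) (m≤m+n _ _)
    ball𝟎-overlap₁ {suc n} (F.suc b ∷ c) d≡1
      with refl ← dist≡0⇒≡ {xs = 𝟎 n} {c} (suc-injective d≡1)
      rewrite count-ball𝟎-suc (λ x → dist x (F.suc b ∷ 𝟎 n) ≤? 1) =
      +-mono-≤ (count-∈ (λ x → dist (F.zero ∷ x) (F.suc b ∷ 𝟎 n) ≤? 1) 𝟎∈ball𝟎 (s≤s 𝟎≤0))
               (≤-reflexive (sym all-near-b))
      where
      𝟎≤0 : dist (𝟎 n) (𝟎 n) ≤ 0
      𝟎≤0 = ≤-reflexive (dist-refl (𝟎 n))
      𝟎∈ball𝟎 : 𝟎 n ∈ ball𝟎 n
      𝟎∈ball𝟎 = ball𝟎-complete (≤-trans 𝟎≤0 z≤n)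
      all-near-b : count (λ a → dist (F.suc a ∷ 𝟎 n) (F.suc b ∷ 𝟎 n) ≤? 1) (allFin m) ≡ m
      all-near-b = trans (count-all _ (universal (λ a → dist-∷-≤1 (F.suc a) (F.suc b) (𝟎 n)) (allFin m)))
                         (length-tabulate (λ a → a))

    ball𝟎-overlap₂ : ∀ {n} (c : Word n (suc m)) → dist (𝟎 n) c ≡ 2 →
                     2 ≤ count (λ x → dist x c ≤? 1) (ball𝟎 n)
    ball𝟎-overlap₂ []          ()
    ball𝟎-overlap₂ {suc n} (F.zero ∷ c) d≡2
      rewrite count-ball𝟎-suc (λ x → dist x (F.zero ∷ c) ≤? 1) =
      ≤-trans (ball𝟎-overlap₂ c d≡2) (m≤m+n _ _)
    ball𝟎-overlap₂ {suc n} (F.suc b ∷ c) d≡2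
      rewrite count-ball𝟎-suc (λ x → dist x (F.suc b ∷ c) ≤? 1) =
      +-mono-≤ (count-∈ (λ x → dist (F.zero ∷ x) (F.suc b ∷ c) ≤? 1) c∈ball𝟎
                        (s≤s (≤-reflexive (dist-refl c))))
               (count-∈ (λ a → dist (F.suc a ∷ 𝟎 n) (F.suc b ∷ c) ≤? 1) (∈-allFin b)
                        (≤-reflexive (trans (dist-∷-same (F.suc b) (𝟎 n) c) (suc-injective d≡2))))
      where
      c∈ball𝟎 : c ∈ ball𝟎 n
      c∈ball𝟎 = ball𝟎-complete (≤-reflexive (suc-injective d≡2))

    ball𝟎-overlap : ∀ {n} (c : Word n (suc m)) →
                    w₀₁₂ (suc (n * m)) (suc m) 2 (dist (𝟎 n) c) ≤ count (λ x → dist x c ≤? 1) (ball𝟎 n)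
    ball𝟎-overlap {n} c with dist (𝟎 n) c in d≡
    ... | 0                 = ball𝟎-overlap₀ c d≡
    ... | 1                 = ball𝟎-overlap₁ c d≡
    ... | 2                 = ball𝟎-overlap₂ c d≡
    ... | suc (suc (suc _)) = z≤n

  module _ {m n λ' : ℕ} (C : List (Word n (suc m))) (packing : IsPacking λ' C) where

    A₀+A₁≤λ : A C (𝟎 n) 0 + A C (𝟎 n) 1 ≤ λ'
    A₀+A₁≤λ = subst (_≤ λ') (count-≤1 (dist (𝟎 n)) C) (packing (𝟎 n))

    ball𝟎-double-count : suc (n * m) * A C (𝟎 n) 0 + suc m * A C (𝟎 n) 1 + 2 * A C (𝟎 n) 2 ≤
                         suc (n * m) * λ'
    ball𝟎-double-count = begin
      suc (n * m) * A C (𝟎 n) 0 + suc m * A C (𝟎 n) 1 + 2 * A C (𝟎 n) 2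
        ≡⟨ ∑-w₀₁₂ (dist (𝟎 n)) _ _ _ C ⟨
      ∑ (λ c → w₀₁₂ (suc (n * m)) (suc m) 2 (dist (𝟎 n) c)) C
        ≤⟨ ∑-mono-≤ ball𝟎-overlap C ⟩
      ∑ (λ c → count (λ x → dist x c ≤? 1) (ball𝟎 n)) C
        ≡⟨ ∑-count-comm (λ x c → dist x c ≤? 1) (ball𝟎 n) C ⟨
      ∑ (ballCount C) (ball𝟎 n)
        ≤⟨ ∑≤length* packing (ball𝟎 n) ⟩
      length (ball𝟎 n) * λ'
        ≡⟨ cong (_* λ') (length-ball𝟎 n) ⟩
      suc (n * m) * λ' ∎
      where open ≤-Reasoning

  A₀-positive : ∀ {m n} {C : List (Word n (suc m))} → 𝟎 n ∈ C → 1 ≤ A C (𝟎 n) 0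
  A₀-positive {n = n} 𝟎∈C = count-∈ (λ c → dist (𝟎 n) c ≟ 0) 𝟎∈C (dist-refl (𝟎 n))

  -- With q = 2 + k, A₀ = 1 + u and λ = A₀ + A₁ + s: R − L − (q − 1) is at least the excess
  -- u(q − 1) + s(q − 2).
  weight-slack : ∀ n k u a₁ a₂ s →
                 suc (n * suc k) * suc u + suc (suc k) * a₁ + 2 * a₂ ≤ suc (n * suc k) * (suc u + a₁ + s) →
                 n * suc k * suc u + 2 * suc k * a₁ + 2 * a₂ + suc k + (u * suc k + s * k) ≤
                 (n + 1) * suc k * (suc u + a₁ + s)
  weight-slack n k u a₁ a₂ s h = begin
    n * suc k * suc u + 2 * suc k * a₁ + 2 * a₂ + suc k + (u * suc k + s * k)
      ≡⟨ regroup n k u a₁ a₂ s ⟩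
    suc (n * suc k) * suc u + suc (suc k) * a₁ + 2 * a₂ + k * (suc u + a₁ + s)
      ≤⟨ +-monoˡ-≤ (k * (suc u + a₁ + s)) h ⟩
    suc (n * suc k) * (suc u + a₁ + s) + k * (suc u + a₁ + s)
      ≡⟨ collect n k (suc u + a₁ + s) ⟩
    (n + 1) * suc k * (suc u + a₁ + s) ∎
    where
    open ≤-Reasoning
    regroup : ∀ n k u a₁ a₂ s →
              n * suc k * suc u + 2 * suc k * a₁ + 2 * a₂ + suc k + (u * suc k + s * k) ≡
              suc (n * suc k) * suc u + suc (suc k) * a₁ + 2 * a₂ + k * (suc u + a₁ + s)
    regroup = solve-∀
    collect : ∀ n k l → suc (n * suc k) * l + k * l ≡ (n + 1) * suc k * l
    collect = solve-∀

  excess-small : ∀ k u s e → u * suc k + s * k ≤ e → e < k → u ≡ 0 × s ≡ 0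
  excess-small k zero    zero    e _  _   = refl , refl
  excess-small k (suc u) s       e le e<k = contradiction (≤-trans k≤excess le) (<⇒≱ e<k)
    where
    k≤excess : k ≤ suc u * suc k + s * k
    k≤excess = ≤-trans (n≤1+n k) (≤-trans (m≤m+n (suc k) (u * suc k)) (m≤m+n _ (s * k)))
  excess-small k zero    (suc s) e le e<k = contradiction (≤-trans (m≤m+n k (s * k)) le) (<⇒≱ e<k)

  ¬2∣suc-even : ∀ {m} → 2 ∣ m → ¬ 2 ∣ suc m
  ¬2∣suc-even {m} 2∣m 2∣1+m with () ← ∣1⇒≡1 (∣m+n∣m⇒∣n (subst (2 ∣_) (+-comm 1 m) 2∣1+m) 2∣m)

  even-gap : ∀ n m λ' a₀ a₁ a₂ → 2 ∣ suc m → 2 ∣ n → 2 ∣ λ' →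
             n * m * a₀ + 2 * m * a₁ + 2 * a₂ + m ≢ (n + 1) * m * λ'
  even-gap n m λ' a₀ a₁ a₂ 2∣q 2∣n 2∣λ eq = ¬2∣suc-even 2∣m 2∣q
    where
    2∣L : 2 ∣ n * m * a₀ + 2 * m * a₁ + 2 * a₂
    2∣L = ∣m∣n⇒∣m+n (∣m∣n⇒∣m+n (∣m⇒∣m*n a₀ (∣m⇒∣m*n m 2∣n)) (∣m⇒∣m*n a₁ (m∣m*n m))) (m∣m*n a₂)
    2∣m : 2 ∣ m
    2∣m = ∣m+n∣m⇒∣n (subst (2 ∣_) (sym eq) (∣n⇒∣m*n ((n + 1) * m) 2∣λ)) 2∣L

  2∣3+j⇒1≤j : ∀ j → 2 ∣ 3 + j → 1 ≤ j
  2∣3+j⇒1≤j zero    2∣3 = contradiction 2∣3 (¬2∣suc-even (m∣m*n 1))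
  2∣3+j⇒1≤j (suc j) _   = s≤s z≤n

open import Data.Integer using (+_; _-_; _≤_)
import Data.Integer as ℤ
import Data.Integer.Properties as ℤ
import Data.Integer.Tactic.RingSolver as ℤ-Solver

+[m+n]-+n≡+m : ∀ a b → + (a + b) - + b ≡ + a
+[m+n]-+n≡+m a b = trans (cong (_- + b) (ℤ.pos-+ a b)) (cancel (+ a) (+ b))
  where
  cancel : ∀ i j → i ℤ.+ j - j ≡ i
  cancel = ℤ-Solver.solve-∀

i-+[1+k]+1≡i-+k : ∀ i k → i - + suc k ℤ.+ + 1 ≡ i - + k
i-+[1+k]+1≡i-+k i k rewrite ℤ.pos-+ 1 k = cancel i (+ k)
  where
  cancel : ∀ i j → i - (+ 1 ℤ.+ j) ℤ.+ + 1 ≡ i - j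
  cancel = ℤ-Solver.solve-∀

m+n≤o⇒+m≤+o-+n : ∀ {a b c} → a + b ℕ.≤ c → + a ≤ + c - + b
m+n≤o⇒+m≤+o-+n {a} {b} a+b≤c =
  subst (_≤ _) (+[m+n]-+n≡+m a b) (ℤ.+-monoˡ-≤ (ℤ.- + b) (ℤ.+≤+ a+b≤c))

+m≡+o-+n⇒m+n≡o : ∀ {a b c} → + a ≡ + c - + b → a + b ≡ c
+m≡+o-+n⇒m+n≡o {a} {b} {c} eq = ℤ.+-injective (begin
  + (a + b)          ≡⟨ ℤ.pos-+ a b ⟩
  + a ℤ.+ + b        ≡⟨ cong (ℤ._+ + b) eq ⟩
  + c - + b ℤ.+ + b  ≡⟨ cancel (+ c) (+ b) ⟩
  + c                ∎)
  where
  open ≡-Reasoning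
  cancel : ∀ i j → i - j ℤ.+ j ≡ i
  cancel = ℤ-Solver.solve-∀

weight-bounds : ∀ n j λ' a₀ a₁ a₂ → 1 ℕ.≤ a₀ → a₀ + a₁ ℕ.≤ λ' →
  suc (n * suc (suc j)) * a₀ + suc (suc (suc j)) * a₁ + 2 * a₂ ℕ.≤ suc (n * suc (suc j)) * λ' →
  let q = suc (suc (suc j))
      L = n * (q ∸ 1) * a₀ + 2 * (q ∸ 1) * a₁ + 2 * a₂
      R = (n + 1) * (q ∸ 1) * λ'
  in (+ L ≤ + R - + q ℤ.+ + 1)
     × ((2 ∣ q × 2 ∣ n × 2 ∣ λ') → + L ≤ + R - + q)
     × ((+ L ≡ + R - + q ℤ.+ + 1 ⊎ (2 ∣ q × 2 ∣ n × 2 ∣ λ' × + L ≡ + R - + q)) → (a₀ ≡ 1 × a₁ ≡ λ' ∸ 1))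
weight-bounds n j λ' (suc u) a₁ a₂ _ a₀+a₁≤λ ball-bound with s , refl ← m≤n⇒∃[o]m+o≡n a₀+a₁≤λ =
  bound , even-bound , equality
  where
  m L R : ℕ
  m = suc (suc j)
  L = n * m * suc u + 2 * m * a₁ + 2 * a₂
  R = (n + 1) * m * (suc u + a₁ + s)

  L+m+excess≤R : L + m + (u * m + s * suc j) ℕ.≤ R
  L+m+excess≤R = weight-slack n (suc j) u a₁ a₂ s ball-bound

  L+m≤R : L + m ℕ.≤ R
  L+m≤R = ≤-trans (m≤m+n (L + m) _) L+m+excess≤R

  tight : ∀ e → L + m + e ≡ R → e < suc j → suc u ≡ 1 × a₁ ≡ suc u + a₁ + s ∸ 1
  tight e L+m+e≡R e<k = conclude (excess-small (suc j) u s e excess≤e e<k)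
    where
    excess≤e : u * m + s * suc j ℕ.≤ e
    excess≤e = +-cancelˡ-≤ (L + m) _ _
      (subst (λ r → L + m + (u * m + s * suc j) ℕ.≤ r) (sym L+m+e≡R) L+m+excess≤R)
    conclude : u ≡ 0 × s ≡ 0 → suc u ≡ 1 × a₁ ≡ suc u + a₁ + s ∸ 1
    conclude (u≡0 , s≡0) =
      cong suc u≡0 , sym (trans (cong₂ (λ u s → u + a₁ + s) u≡0 s≡0) (+-identityʳ a₁))

  bound : + L ≤ + R - + suc m ℤ.+ + 1
  bound rewrite i-+[1+k]+1≡i-+k (+ R) m = m+n≤o⇒+m≤+o-+n L+m≤R

  even-bound : 2 ∣ suc m × 2 ∣ n × 2 ∣ suc u + a₁ + s → + L ≤ + R - + suc m
  even-bound (2∣q , 2∣n , 2∣λ) = m+n≤o⇒+m≤+o-+n (subst (ℕ._≤ R) (sym (+-suc L m))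
    (≤∧≢⇒< L+m≤R (even-gap n m _ (suc u) a₁ a₂ 2∣q 2∣n 2∣λ)))

  equality : + L ≡ + R - + suc m ℤ.+ + 1 ⊎ (2 ∣ suc m × 2 ∣ n × 2 ∣ suc u + a₁ + s × + L ≡ + R - + suc m) →
             suc u ≡ 1 × a₁ ≡ suc u + a₁ + s ∸ 1
  equality (inj₁ eq) =
    tight 0 (trans (+-identityʳ (L + m)) (+m≡+o-+n⇒m+n≡o (trans eq (i-+[1+k]+1≡i-+k (+ R) m))))
            (s≤s z≤n)
  equality (inj₂ (2∣q , _ , _ , eq)) =
    tight 1 (trans (+-comm (L + m) 1) (trans (sym (+-suc L m)) (+m≡+o-+n⇒m+n≡o eq)))
            (s≤s (2∣3+j⇒1≤j j 2∣q))

corollary1 : (n q λ' : ℕ) (q>2 : 2 < q) (C : List (Word n q))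
    → IsPacking λ' C
    → zeroWord n q>2 ∈ C
    → let A₀ = A C (zeroWord n q>2) 0
          A₁ = A C (zeroWord n q>2) 1
          A₂ = A C (zeroWord n q>2) 2
          L = + (n * (q ∸ 1) * A₀ + 2 * (q ∸ 1) * A₁ + 2 * A₂)
          R = + ((n + 1) * (q ∸ 1) * λ')
      in (L ≤ R - + q ℤ.+ + 1)
         × ((2 ∣ q × 2 ∣ n × 2 ∣ λ') → L ≤ R - + q)
         × ((L ≡ R - + q ℤ.+ + 1 ⊎ (2 ∣ q × 2 ∣ n × 2 ∣ λ' × L ≡ R - + q))
            → (A₀ ≡ 1 × A₁ ≡ λ' ∸ 1))
corollary1 n (suc (suc (suc j))) λ' (s≤s (s≤s (s≤s z≤n))) C packing 𝟎∈C =
  weight-bounds n j λ' (A C (𝟎 n) 0) (A C (𝟎 n) 1) (A C (𝟎 n) 2)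
    (A₀-positive 𝟎∈C) (A₀+A₁≤λ C packing) (ball𝟎-double-count C packing)
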